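{- Let $q$ be a prime power, $\Lambda(X)=X^q-X\in\mathbb{F}_q[X]$. Suppose $U(X),V(X)\in\mathbb{F}_q[X]$ with $\deg(V)<q$, $i\ge0$ an integer, and $U(X)=V(X)\cdot\Lambda^i(X)$. Then for every integer $\ell$ with $0\le\ell<q$, $$U^{[\ell]}(X)\equiv(-1)^i\cdot V^{[\ell-i]}(X)\pmod{\Lambda(X)},$$ with the convention that $V^{[j]}(X)=0$ for $j<0$.
   Context: For a field $\mathbb{F}$ and $A(X)\in\mathbb{F}[X]$, the $\ell$-th Hasse derivative $A^{[\ell]}(X)$ is the coefficient of $Z^\ell$ in the expansion $A(X+Z)=\sum_{\ell\ge0}A^{[\ell]}(X)Z^\ell$ in $\mathbb{F}[X][Z]$. -}

module Defs where

open import Level using (Level; _⊔_)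
open import Data.Nat as ℕ using (ℕ; zero; suc)
open import Data.Nat.Primality using (Prime)
open import Data.Fin using (Fin)
open import Data.List using (List; []; _∷_; map)
open import Data.Product using (Σ; ∃; _×_; _,_)
open import Relation.Nullary using (¬_)
open import Relation.Binary.PropositionalEquality as ≡ using (_≡_)
open import Algebra.Bundles using (CommutativeRing)
open import Function.Bundles using (Inverse)

IsPrimePower : ℕ → Set
IsPrimePower q = Σ ℕ λ p → Σ ℕ λ k → Prime p × q ≡ p ℕ.^ suc k

-- Generic dense univariate polynomials over a "raw" structure,
-- represented by coefficient lists, lowest degree first
-- (trailing zeros allowed; equality is taken coefficientwise).
module PolyOps {a} (A : Set a) (0A : A) (_+A_ _*A_ : A → A → A) where

  Poly : Set a
  Poly = List A

  coeff : Poly → ℕ → A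
  coeff []      _       = 0A
  coeff (x ∷ p) zero    = x
  coeff (x ∷ p) (suc n) = coeff p n

  infixl 6 _+ₚ_
  infixl 7 _*ₚ_

  _+ₚ_ : Poly → Poly → Poly
  []      +ₚ q       = q
  (x ∷ p) +ₚ []      = x ∷ p
  (x ∷ p) +ₚ (y ∷ q) = (x +A y) ∷ (p +ₚ q)

  scale : A → Poly → Poly
  scale c p = map (c *A_) p

  _*ₚ_ : Poly → Poly → Poly
  []      *ₚ q = []
  (x ∷ p) *ₚ q = scale x q +ₚ (0A ∷ (p *ₚ q))

module FieldPoly {c ℓ} (R : CommutativeRing c ℓ) where
  open CommutativeRing R renaming (Carrier to F)

  open PolyOps F 0# _+_ _*_ public

  infix 4 _≈ₚ_
  _≈ₚ_ : Poly → Poly → Set ℓ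
  p ≈ₚ q = ∀ n → coeff p n ≈ coeff q n

  -_ₚ : Poly → Poly
  -_ₚ p = map (-_) p

  _-ₚ_ : Poly → Poly → Poly
  p -ₚ q = p +ₚ (-_ₚ q)

  monomial : ℕ → Poly
  monomial zero    = 1# ∷ []
  monomial (suc n) = 0# ∷ monomial n

  X : Poly
  X = monomial 1

  Λ : ℕ → Poly
  Λ q = monomial q -ₚ X

  _^ₚ_ : Poly → ℕ → Poly
  p ^ₚ zero  = 1# ∷ []
  p ^ₚ suc n = p *ₚ (p ^ₚ n)

  -- deg p < n  (the zero polynomial has degree -∞)
  degLt : Poly → ℕ → Set ℓ
  degLt p n = ∀ m → n ℕ.≤ m → coeff p m ≈ 0#

  signPow : ℕ → F
  signPow zero    = 1#
  signPow (suc i) = - signPow i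

  -- Bivariate polynomials: polynomials in Z with coefficients in F[X]
  module PP = PolyOps Poly [] _+ₚ_ _*ₚ_

  -- A(X+Z) ∈ F[X][Z], computed by Horner's rule
  shiftSubst : Poly → PP.Poly
  shiftSubst []      = []
  shiftSubst (a ∷ p) = ((a ∷ []) ∷ []) PP.+ₚ ((X ∷ (1# ∷ []) ∷ []) PP.*ₚ shiftSubst p)

  -- ℓ-th Hasse derivative: coefficient of Z^ℓ in A(X+Z)
  hasse : ℕ → Poly → Poly
  hasse l A = PP.coeff (shiftSubst A) l

  -- V^[ℓ - i], with the convention V^[j] = 0 for j < 0
  hasseSub : ℕ → ℕ → Poly → Poly
  hasseSub l       zero    V = hasse l V
  hasseSub zero    (suc i) V = []
  hasseSub (suc l) (suc i) V = hasseSub l i V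

  CongMod : Poly → Poly → Poly → Set (c ⊔ ℓ)
  CongMod A B M = Σ Poly λ W → (A -ₚ B) ≈ₚ (W *ₚ M)

record IsField {c ℓ} (R : CommutativeRing c ℓ) : Set (c ⊔ ℓ) where
  open CommutativeRing R
  field
    0≉1 : ¬ (0# ≈ 1#)
    inverse : ∀ x → ¬ (x ≈ 0#) → Σ Carrier λ y → (x * y) ≈ 1#

HasCardinality : ∀ {c ℓ} (R : CommutativeRing c ℓ) → ℕ → Set (c ⊔ ℓ)
HasCardinality R q = Inverse (≡.setoid (Fin q)) (CommutativeRing.setoid R)

-- Write a^[l] for the l-th Hasse derivative; its n-th coefficient is C(l + n, l) a_(l+n).
-- For Λ = X^q - X and l + 1 < q one has (A Λ)^[l+1] = Λ A^[l+1] - A^[l]: the term X^q contributes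
-- C(q + s, j) = C(s, j), because the binomials C(q, j) with 0 < j < q vanish in characteristic p,
-- and the term -X contributes -(X A^[l+1] + A^[l]) by Pascal's rule.  So (A Λ)^[l+1] ≡ -A^[l] and
-- (A Λ)^[0] ≡ 0 modulo Λ, and induction on i gives the claim.  The binomials vanish because
-- translation by 1 permutes F, so q·1 = 0, and hence p·1 = 0 as F has no zero divisors.

module Submission where

open import Defs
open import Data.Nat as ℕ using (ℕ; zero; suc; _<_; s≤s)
import Data.Nat.Properties as ℕ
open import Data.Nat.Combinatorics using (_C_; nCn≡1; k>n⇒nCk≡0; nCk+nC[k+1]≡[n+1]C[k+1])
open import Data.Nat.Divisibility using (divides)
open import Data.Fin as Fin using (Fin)
open import Data.Fin.Permutation using (permutation)
open import Data.List using ([]; _∷_)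
open import Data.Product using (_,_)
open import Algebra.Bundles using (CommutativeRing)
open import Algebra.Properties.CommutativeSemigroup ℕ.+-commutativeSemigroup
  using () renaming (x∙yz≈y∙xz to m+[n+o]≡n+[m+o])
open import Function using (_∘_)
open import Function.Bundles using (Inverse)
open import Function.Properties.Inverse using (Inverse⇒Injection)
import Function.Construct.Symmetry as Symmetry
open import Level using (_⊔_)
open import Relation.Nullary using (¬_; yes; no)
open import Relation.Nullary.Decidable using (via-injection; decidable-stable)
open import Relation.Binary.Bundles using (Setoid)
open import Relation.Binary.Definitions using (Decidable)
import Relation.Binary.PropositionalEquality as ≡

module Binomial where
  open import Data.Nat using (_+_; _*_; _^_)
  open import Data.Nat.Properties using (*-comm; *-assoc; *-zeroʳ; *-distribˡ-+; +-assoc; <⇒≱)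
  open import Data.Nat.Combinatorics using (nC1≡n)
  open import Data.Nat.Divisibility
  open import Data.Nat.Primality using (Prime; euclidsLemma; prime⇒nonZero)
  open import Data.Sum using (inj₁; inj₂)
  open import Data.Empty using (⊥-elim)
  open import Relation.Binary.PropositionalEquality

  [k+1]*[n+1]C[k+1]≡[n+1]*nCk : ∀ n k → suc k * (suc n C suc k) ≡ suc n * (n C k)
  [k+1]*[n+1]C[k+1]≡[n+1]*nCk n zero = begin
    1 * (suc n C 1) ≡⟨ cong (1 *_) (nC1≡n (suc n)) ⟩
    1 * suc n       ≡⟨ *-comm 1 (suc n) ⟩
    suc n * 1       ∎
    where open ≡-Reasoning
  [k+1]*[n+1]C[k+1]≡[n+1]*nCk zero (suc k) = *-zeroʳ (suc (suc k))
  [k+1]*[n+1]C[k+1]≡[n+1]*nCk (suc n) (suc k) = begin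
    suc (suc k) * (suc (suc n) C suc (suc k))
      ≡⟨ cong (suc (suc k) *_) (nCk+nC[k+1]≡[n+1]C[k+1] (suc n) (suc k)) ⟨
    suc (suc k) * (c₁ + suc n C suc (suc k))
      ≡⟨ *-distribˡ-+ (suc (suc k)) c₁ _ ⟩
    (c₁ + suc k * c₁) + suc (suc k) * (suc n C suc (suc k))
      ≡⟨ cong₂ (λ x y → (c₁ + x) + y) ([k+1]*[n+1]C[k+1]≡[n+1]*nCk n k)
                                     ([k+1]*[n+1]C[k+1]≡[n+1]*nCk n (suc k)) ⟩
    (c₁ + suc n * (n C k)) + suc n * (n C suc k)
      ≡⟨ +-assoc c₁ _ _ ⟩
    c₁ + (suc n * (n C k) + suc n * (n C suc k))
      ≡⟨ cong (c₁ +_) (*-distribˡ-+ (suc n) (n C k) _) ⟨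
    c₁ + suc n * (n C k + n C suc k)
      ≡⟨ cong (λ x → c₁ + suc n * x) (nCk+nC[k+1]≡[n+1]C[k+1] n k) ⟩
    suc (suc n) * c₁ ∎
    where
    c₁ = suc n C suc k
    open ≡-Reasoning

  n∣k*nCk : ∀ n k → n ∣ k * (n C k)
  n∣k*nCk n       zero    = n ∣0
  n∣k*nCk zero    (suc k) = divides 0 (*-zeroʳ (suc k))
  n∣k*nCk (suc n) (suc k) =
    divides (n C k) (trans ([k+1]*[n+1]C[k+1]≡[n+1]*nCk n k) (*-comm (suc n) (n C k)))

  p^e∣m*n∧p^e∤m⇒p∣n : ∀ {p} → Prime p → ∀ e m n → p ^ e ∣ m * n → ¬ (p ^ e ∣ m) → p ∣ n
  p^e∣m*n∧p^e∤m⇒p∣n p-prime zero    m n _ p^e∤m = ⊥-elim (p^e∤m (1∣ m))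
  p^e∣m*n∧p^e∤m⇒p∣n {p} p-prime (suc e) m n p^[1+e]∣mn p^[1+e]∤m
    with euclidsLemma m n p-prime (∣-trans (m∣m*n (p ^ e)) p^[1+e]∣mn)
  ... | inj₂ p∣n = p∣n
  ... | inj₁ (divides m′ refl) = p^e∣m*n∧p^e∤m⇒p∣n p-prime e m′ n p^e∣m′n p^e∤m′
    where
    instance _ = prime⇒nonZero p-prime
    p^e∣m′n : p ^ e ∣ m′ * n
    p^e∣m′n = *-cancelˡ-∣ p (subst (p * p ^ e ∣_) m′pn≡p[m′n] p^[1+e]∣mn)
      where m′pn≡p[m′n] = trans (cong (_* n) (*-comm m′ p)) (*-assoc p m′ n)
    p^e∤m′ : ¬ (p ^ e ∣ m′)
    p^e∤m′ h = p^[1+e]∤m (subst (p * p ^ e ∣_) (*-comm p m′) (*-monoʳ-∣ p h))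

  p∣[p^e]Cj : ∀ {p} → Prime p → ∀ e j → 0 < j → j < p ^ e → p ∣ (p ^ e) C j
  p∣[p^e]Cj p-prime e j@(suc _) _ j<p^e =
    p^e∣m*n∧p^e∤m⇒p∣n p-prime e j _ (n∣k*nCk _ j) (λ p^e∣j → <⇒≱ j<p^e (∣⇒≤ p^e∣j))

open Binomial using (p∣[p^e]Cj)

module Characteristic {c ℓ} (R : CommutativeRing c ℓ) where
  open CommutativeRing R
  open import Algebra.Properties.Ring ring using (+-identityʳ-unique)
  open import Algebra.Properties.Semiring.Mult semiring using (_×_; ×-homo-1; ×1-homo-*)
  open import Relation.Binary.Reasoning.Setoid setoid

  module _ {q} (card : HasCardinality R q) where
    open Inverse card

    ≈-dec : Decidable _≈_
    ≈-dec = via-injection (Inverse⇒Injection (Symmetry.inverse card)) Fin._≟_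

    -- Translation by 1# permutes the carrier, so the sum S of all elements satisfies S ≈ S + q × 1#.
    q×1≈0 : q × 1# ≈ 0#
    q×1≈0 = +-identityʳ-unique S (q × 1#) (sym S≈S+q×1)
      where
      open import Algebra.Properties.CommutativeMonoid.Sum +-commutativeMonoid
        using (sum; sum-permute; sum-cong-≋; ∑-distrib-+; sum-replicate)
      S = sum to
      translate : Fin q → Fin q
      translate i = from (to i + 1#)
      untranslate : Fin q → Fin q
      untranslate i = from (to i - 1#)
      cancel : ∀ x {y z} → y + z ≈ 0# → (x + y) + z ≈ x
      cancel x {y} {z} y+z≈0 = trans (+-assoc x y z) (trans (+-congˡ y+z≈0) (+-identityʳ x))
      translate∘untranslate : ∀ i → translate (untranslate i) ≡.≡ i
      translate∘untranslate i =
        ≡.trans (from-cong (trans (+-congʳ (strictlyInverseˡ _)) (cancel (to i) (-‿inverseˡ 1#)))) (strictlyInverseʳ i)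
      untranslate∘translate : ∀ i → untranslate (translate i) ≡.≡ i
      untranslate∘translate i =
        ≡.trans (from-cong (trans (+-congʳ (strictlyInverseˡ _)) (cancel (to i) (-‿inverseʳ 1#)))) (strictlyInverseʳ i)
      S≈S+q×1 : S ≈ S + q × 1#
      S≈S+q×1 = begin
        S
          ≈⟨ sum-permute to (permutation translate untranslate translate∘untranslate untranslate∘translate) ⟩
        sum (λ i → to (translate i))  ≈⟨ sum-cong-≋ (λ i → strictlyInverseˡ (to i + 1#)) ⟩
        sum (λ i → to i + 1#)         ≈⟨ ∑-distrib-+ to (λ _ → 1#) ⟩
        S + sum {q} (λ _ → 1#)        ≈⟨ +-congˡ (sum-replicate q) ⟩
        S + q × 1#                    ∎

  InteriorBinomialsVanish : ℕ → Set ℓ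
  InteriorBinomialsVanish q = ∀ j → 0 < j → j < q → (q C j) × 1# ≈ 0#

  module _ (isField : IsField R) where
    open IsField isField

    *-nonzero : ∀ {x y} → ¬ x ≈ 0# → ¬ y ≈ 0# → ¬ x * y ≈ 0#
    *-nonzero {x} {y} x≉0 y≉0 xy≈0 with inverse x x≉0
    ... | x⁻¹ , xx⁻¹≈1 = y≉0 (begin
      y              ≈⟨ *-identityˡ y ⟨
      1# * y         ≈⟨ *-congʳ xx⁻¹≈1 ⟨
      (x * x⁻¹) * y  ≈⟨ *-congʳ (*-comm x x⁻¹) ⟩
      (x⁻¹ * x) * y  ≈⟨ *-assoc x⁻¹ x y ⟩
      x⁻¹ * (x * y)  ≈⟨ *-congˡ xy≈0 ⟩
      x⁻¹ * 0#       ≈⟨ zeroʳ x⁻¹ ⟩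
      0#             ∎)

    [m^e]×1≉0 : ∀ {m} → ¬ m × 1# ≈ 0# → ∀ e → ¬ (m ℕ.^ e) × 1# ≈ 0#
    [m^e]×1≉0 m×1≉0 zero    1×1≈0 = 0≉1 (sym (trans (sym (×-homo-1 1#)) 1×1≈0))
    [m^e]×1≉0 {m} m×1≉0 (suc e) [m^1+e]×1≈0 =
      *-nonzero m×1≉0 ([m^e]×1≉0 m×1≉0 e) (trans (sym (×1-homo-* m (m ℕ.^ e))) [m^1+e]×1≈0)

  q-binomials-vanish : IsField R → ∀ q → IsPrimePower q → HasCardinality R q → InteriorBinomialsVanish q
  q-binomials-vanish isField q (p , k , p-prime , ≡.refl) card j 0<j j<q
    with p∣[p^e]Cj p-prime (suc k) j 0<j j<q
  ... | divides t q-C-j≡t*p = begin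
    (q C j) × 1#          ≡⟨ ≡.cong (_× 1#) q-C-j≡t*p ⟩
    (t ℕ.* p) × 1#        ≈⟨ ×1-homo-* t p ⟩
    (t × 1#) * (p × 1#)   ≈⟨ *-congˡ p×1≈0 ⟩
    (t × 1#) * 0#         ≈⟨ zeroʳ _ ⟩
    0#                    ∎
    where
    p×1≈0 : p × 1# ≈ 0#
    p×1≈0 = decidable-stable (≈-dec card (p × 1#) 0#)
              (λ p×1≉0 → [m^e]×1≉0 isField {p} p×1≉0 (suc k) (q×1≈0 card))

module PolynomialCoefficients {c ℓ} (R : CommutativeRing c ℓ) where
  open CommutativeRing R renaming (Carrier to F)
  open FieldPoly R
  open import Algebra.Properties.Ring ring
    using (-0#≈0#; -‿distribˡ-*; -‿distribʳ-*; -‿+-comm; ⁻¹-anti-homo‿-; x[y-z]≈xy-xz)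
  open import Algebra.Properties.CommutativeSemigroup +-commutativeSemigroup using (interchange)
  open import Relation.Binary.Reasoning.Setoid setoid

  Seq : Set c
  Seq = ℕ → F

  coeff-+ₚ : ∀ p r n → coeff (p +ₚ r) n ≈ coeff p n + coeff r n
  coeff-+ₚ []      r       n       = sym (+-identityˡ _)
  coeff-+ₚ (x ∷ p) []      zero    = sym (+-identityʳ x)
  coeff-+ₚ (x ∷ p) []      (suc n) = sym (+-identityʳ _)
  coeff-+ₚ (x ∷ p) (y ∷ r) zero    = refl
  coeff-+ₚ (x ∷ p) (y ∷ r) (suc n) = coeff-+ₚ p r n

  coeff-scale : ∀ x p n → coeff (scale x p) n ≈ x * coeff p n
  coeff-scale x []      n       = sym (zeroʳ x)
  coeff-scale x (y ∷ p) zero    = refl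
  coeff-scale x (y ∷ p) (suc n) = coeff-scale x p n

  coeff-negₚ : ∀ p n → coeff (-_ₚ p) n ≈ - coeff p n
  coeff-negₚ []      n       = sym -0#≈0#
  coeff-negₚ (y ∷ p) zero    = refl
  coeff-negₚ (y ∷ p) (suc n) = coeff-negₚ p n

  coeff--ₚ : ∀ p r n → coeff (p -ₚ r) n ≈ coeff p n - coeff r n
  coeff--ₚ p r n = trans (coeff-+ₚ p (-_ₚ r) n) (+-congˡ (coeff-negₚ r n))

  -- Cauchy product, recursing on the first factor as _*ₚ_ does.
  conv : Seq → Seq → Seq
  conv a b zero    = a 0 * b 0
  conv a b (suc n) = a 0 * b (suc n) + conv (λ k → a (suc k)) b n

  conv-zeroˡ : ∀ (b : Seq) n → conv (λ _ → 0#) b n ≈ 0#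
  conv-zeroˡ b zero    = zeroˡ (b 0)
  conv-zeroˡ b (suc n) = trans (+-cong (zeroˡ _) (conv-zeroˡ b n)) (+-identityˡ 0#)

  coeff-*ₚ : ∀ p r n → coeff (p *ₚ r) n ≈ conv (coeff p) (coeff r) n
  coeff-*ₚ []      r n       = sym (conv-zeroˡ (coeff r) n)
  coeff-*ₚ (x ∷ p) r zero    = trans (coeff-+ₚ (scale x r) _ 0) (trans (+-identityʳ _) (coeff-scale x r 0))
  coeff-*ₚ (x ∷ p) r (suc n) =
    trans (coeff-+ₚ (scale x r) _ (suc n)) (+-cong (coeff-scale x r (suc n)) (coeff-*ₚ p r n))

  coeff-*ₚ[] : ∀ p n → coeff (p *ₚ []) n ≈ 0#
  coeff-*ₚ[] []      n       = refl
  coeff-*ₚ[] (x ∷ p) zero    = refl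
  coeff-*ₚ[] (x ∷ p) (suc n) = coeff-*ₚ[] p n

  conv-cong : ∀ {a a′ b b′ : Seq} → (∀ k → a k ≈ a′ k) → (∀ k → b k ≈ b′ k) →
              ∀ n → conv a b n ≈ conv a′ b′ n
  conv-cong a≈a′ b≈b′ zero    = *-cong (a≈a′ 0) (b≈b′ 0)
  conv-cong a≈a′ b≈b′ (suc n) =
    +-cong (*-cong (a≈a′ 0) (b≈b′ (suc n))) (conv-cong (λ k → a≈a′ (suc k)) b≈b′ n)

  conv-+ˡ : ∀ (a a′ b : Seq) n → conv (λ k → a k + a′ k) b n ≈ conv a b n + conv a′ b n
  conv-+ˡ a a′ b zero    = distribʳ (b 0) (a 0) (a′ 0)
  conv-+ˡ a a′ b (suc n) =
    trans (+-cong (distribʳ _ _ _) (conv-+ˡ (λ k → a (suc k)) (λ k → a′ (suc k)) b n)) (interchange _ _ _ _)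

  conv-+ʳ : ∀ (a b b′ : Seq) n → conv a (λ k → b k + b′ k) n ≈ conv a b n + conv a b′ n
  conv-+ʳ a b b′ zero    = distribˡ (a 0) (b 0) (b′ 0)
  conv-+ʳ a b b′ (suc n) =
    trans (+-cong (distribˡ _ _ _) (conv-+ʳ (λ k → a (suc k)) b b′ n)) (interchange _ _ _ _)

  conv-*ˡ : ∀ x (a b : Seq) n → conv (λ k → x * a k) b n ≈ x * conv a b n
  conv-*ˡ x a b zero    = *-assoc x (a 0) (b 0)
  conv-*ˡ x a b (suc n) =
    trans (+-cong (*-assoc _ _ _) (conv-*ˡ x (λ k → a (suc k)) b n)) (sym (distribˡ _ _ _))

  conv-negˡ : ∀ (a b : Seq) n → conv (λ k → - a k) b n ≈ - conv a b n
  conv-negˡ a b zero    = sym (-‿distribˡ-* _ _)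
  conv-negˡ a b (suc n) =
    trans (+-cong (sym (-‿distribˡ-* _ _)) (conv-negˡ (λ k → a (suc k)) b n)) (-‿+-comm _ _)

  conv-negʳ : ∀ (a b : Seq) n → conv a (λ k → - b k) n ≈ - conv a b n
  conv-negʳ a b zero    = sym (-‿distribʳ-* _ _)
  conv-negʳ a b (suc n) =
    trans (+-cong (sym (-‿distribʳ-* _ _)) (conv-negʳ (λ k → a (suc k)) b n)) (-‿+-comm _ _)

  shift : ℕ → Seq → Seq
  shift zero    a n       = a n
  shift (suc k) a zero    = 0#
  shift (suc k) a (suc n) = shift k a n

  shift-cong : ∀ k {a b : Seq} → (∀ n → a n ≈ b n) → ∀ n → shift k a n ≈ shift k b n
  shift-cong zero    a≈b n       = a≈b n
  shift-cong (suc k) a≈b zero    = refl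
  shift-cong (suc k) a≈b (suc n) = shift-cong k a≈b n

  shift-< : ∀ k (a : Seq) {n} → n ℕ.< k → shift k a n ≡.≡ 0#
  shift-< (suc k) a {zero}  _         = ≡.refl
  shift-< (suc k) a {suc n} (s≤s n<k) = shift-< k a n<k

  shift-+ : ∀ k (a : Seq) n → shift k a (k ℕ.+ n) ≡.≡ a n
  shift-+ zero    a n = ≡.refl
  shift-+ (suc k) a n = shift-+ k a n

  shift-suc : ∀ k (a : Seq) n → shift (suc k) a n ≡.≡ shift 1 (shift k a) n
  shift-suc k a zero    = ≡.refl
  shift-suc k a (suc n) = ≡.refl

  conv-shiftˡ : ∀ k (a b : Seq) n → conv (shift k a) b n ≈ shift k (conv a b) n
  conv-shiftˡ zero    a b n       = refl
  conv-shiftˡ (suc k) a b zero    = zeroˡ (b 0)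
  conv-shiftˡ (suc k) a b (suc n) = trans (+-cong (zeroˡ _) (conv-shiftˡ k a b n)) (+-identityˡ _)

  conv-shift1ʳ : ∀ (a b : Seq) n → conv a (shift 1 b) n ≈ shift 1 (conv a b) n
  conv-shift1ʳ a b zero          = zeroʳ (a 0)
  conv-shift1ʳ a b (suc zero)    = trans (+-congˡ (zeroʳ _)) (+-identityʳ _)
  conv-shift1ʳ a b (suc (suc n)) = +-congˡ (conv-shift1ʳ (λ k → a (suc k)) b (suc n))

  conv-shiftʳ : ∀ k (a b : Seq) n → conv a (shift k b) n ≈ shift k (conv a b) n
  conv-shiftʳ zero    a b n = refl
  conv-shiftʳ (suc k) a b n = begin
    conv a (shift (suc k) b) n           ≈⟨ conv-cong (λ _ → refl) (reflexive ∘ shift-suc k b) n ⟩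
    conv a (shift 1 (shift k b)) n       ≈⟨ conv-shift1ʳ a (shift k b) n ⟩
    shift 1 (conv a (shift k b)) n       ≈⟨ shift-cong 1 (conv-shiftʳ k a b) n ⟩
    shift 1 (shift k (conv a b)) n       ≡⟨ shift-suc k (conv a b) n ⟨
    shift (suc k) (conv a b) n           ∎

  δ : Seq
  δ = coeff (1# ∷ [])

  conv-identityˡ : ∀ (b : Seq) n → conv δ b n ≈ b n
  conv-identityˡ b zero    = *-identityˡ (b 0)
  conv-identityˡ b (suc n) = trans (+-cong (*-identityˡ _) (conv-zeroˡ b n)) (+-identityʳ _)

  conv-identityʳ : ∀ (a : Seq) n → conv a δ n ≈ a n
  conv-identityʳ a zero    = *-identityʳ (a 0)
  conv-identityʳ a (suc n) = trans (+-cong (zeroʳ _) (conv-identityʳ (λ k → a (suc k)) n)) (+-identityˡ _)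

  coeff-monomial : ∀ k n → coeff (monomial k) n ≈ shift k δ n
  coeff-monomial zero    n       = refl
  coeff-monomial (suc k) zero    = refl
  coeff-monomial (suc k) (suc n) = coeff-monomial k n

  coeff-1*ₚ : ∀ p n → coeff ((1# ∷ []) *ₚ p) n ≈ coeff p n
  coeff-1*ₚ p n = trans (coeff-*ₚ (1# ∷ []) p n) (conv-identityˡ (coeff p) n)

  coeff-*ₚ1 : ∀ p n → coeff (p *ₚ (1# ∷ [])) n ≈ coeff p n
  coeff-*ₚ1 p n = trans (coeff-*ₚ p (1# ∷ []) n) (conv-identityʳ (coeff p) n)

  coeff-X*ₚ : ∀ p n → coeff (X *ₚ p) n ≈ shift 1 (coeff p) n
  coeff-X*ₚ p n = begin
    coeff (X *ₚ p) n                     ≈⟨ coeff-*ₚ X p n ⟩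
    conv (coeff X) (coeff p) n           ≈⟨ conv-cong (coeff-monomial 1) (λ _ → refl) n ⟩
    conv (shift 1 δ) (coeff p) n         ≈⟨ conv-shiftˡ 1 δ (coeff p) n ⟩
    shift 1 (conv δ (coeff p)) n         ≈⟨ shift-cong 1 (conv-identityˡ (coeff p)) n ⟩
    shift 1 (coeff p) n                  ∎

  mulΛ : ℕ → Seq → Seq
  mulΛ q a n = shift q a n - shift 1 a n

  mulΛ-cong : ∀ q {a b : Seq} → (∀ n → a n ≈ b n) → ∀ n → mulΛ q a n ≈ mulΛ q b n
  mulΛ-cong q a≈b n = +-cong (shift-cong q a≈b n) (-‿cong (shift-cong 1 a≈b n))

  conv-mulΛˡ : ∀ q (a b : Seq) n → conv (mulΛ q a) b n ≈ mulΛ q (conv a b) n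
  conv-mulΛˡ q a b n = begin
    conv (mulΛ q a) b n
      ≈⟨ conv-+ˡ (shift q a) (λ k → - shift 1 a k) b n ⟩
    conv (shift q a) b n + conv (λ k → - shift 1 a k) b n
      ≈⟨ +-congˡ (conv-negˡ (shift 1 a) b n) ⟩
    conv (shift q a) b n - conv (shift 1 a) b n
      ≈⟨ +-cong (conv-shiftˡ q a b n) (-‿cong (conv-shiftˡ 1 a b n)) ⟩
    mulΛ q (conv a b) n
      ∎

  conv-mulΛʳ : ∀ q (a b : Seq) n → conv a (mulΛ q b) n ≈ mulΛ q (conv a b) n
  conv-mulΛʳ q a b n = begin
    conv a (mulΛ q b) n
      ≈⟨ conv-+ʳ a (shift q b) (λ k → - shift 1 b k) n ⟩
    conv a (shift q b) n + conv a (λ k → - shift 1 b k) n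
      ≈⟨ +-congˡ (conv-negʳ a (shift 1 b) n) ⟩
    conv a (shift q b) n - conv a (shift 1 b) n
      ≈⟨ +-cong (conv-shiftʳ q a b n) (-‿cong (conv-shiftʳ 1 a b n)) ⟩
    mulΛ q (conv a b) n
      ∎

  coeff-Λ : ∀ q n → coeff (Λ q) n ≈ mulΛ q δ n
  coeff-Λ q n = trans (coeff--ₚ (monomial q) X n) (+-cong (coeff-monomial q n) (-‿cong (coeff-monomial 1 n)))

  coeff-Λ*ₚ : ∀ q p n → coeff (Λ q *ₚ p) n ≈ mulΛ q (coeff p) n
  coeff-Λ*ₚ q p n = begin
    coeff (Λ q *ₚ p) n                   ≈⟨ coeff-*ₚ (Λ q) p n ⟩
    conv (coeff (Λ q)) (coeff p) n       ≈⟨ conv-cong (coeff-Λ q) (λ _ → refl) n ⟩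
    conv (mulΛ q δ) (coeff p) n          ≈⟨ conv-mulΛˡ q δ (coeff p) n ⟩
    mulΛ q (conv δ (coeff p)) n          ≈⟨ mulΛ-cong q (conv-identityˡ (coeff p)) n ⟩
    mulΛ q (coeff p) n                   ∎

  coeff-*ₚΛ : ∀ q p n → coeff (p *ₚ Λ q) n ≈ mulΛ q (coeff p) n
  coeff-*ₚΛ q p n = begin
    coeff (p *ₚ Λ q) n                   ≈⟨ coeff-*ₚ p (Λ q) n ⟩
    conv (coeff p) (coeff (Λ q)) n       ≈⟨ conv-cong (λ _ → refl) (coeff-Λ q) n ⟩
    conv (coeff p) (mulΛ q δ) n          ≈⟨ conv-mulΛʳ q (coeff p) δ n ⟩
    mulΛ q (conv (coeff p) δ) n          ≈⟨ mulΛ-cong q (conv-identityʳ (coeff p)) n ⟩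
    mulΛ q (coeff p) n                   ∎

  *ₚ-Λ-assoc : ∀ q p r → p *ₚ (Λ q *ₚ r) ≈ₚ (p *ₚ Λ q) *ₚ r
  *ₚ-Λ-assoc q p r n = begin
    coeff (p *ₚ (Λ q *ₚ r)) n                  ≈⟨ coeff-*ₚ p (Λ q *ₚ r) n ⟩
    conv (coeff p) (coeff (Λ q *ₚ r)) n        ≈⟨ conv-cong (λ _ → refl) (coeff-Λ*ₚ q r) n ⟩
    conv (coeff p) (mulΛ q (coeff r)) n        ≈⟨ conv-mulΛʳ q (coeff p) (coeff r) n ⟩
    mulΛ q (conv (coeff p) (coeff r)) n        ≈⟨ conv-mulΛˡ q (coeff p) (coeff r) n ⟨
    conv (mulΛ q (coeff p)) (coeff r) n        ≈⟨ conv-cong (coeff-*ₚΛ q p) (λ _ → refl) n ⟨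
    conv (coeff (p *ₚ Λ q)) (coeff r) n        ≈⟨ coeff-*ₚ (p *ₚ Λ q) r n ⟨
    coeff ((p *ₚ Λ q) *ₚ r) n                  ∎

  scale-negₚ : ∀ x p → scale x (-_ₚ p) ≈ₚ scale (- x) p
  scale-negₚ x p n = begin
    coeff (scale x (-_ₚ p)) n  ≈⟨ coeff-scale x (-_ₚ p) n ⟩
    x * coeff (-_ₚ p) n        ≈⟨ *-congˡ (coeff-negₚ p n) ⟩
    x * - coeff p n            ≈⟨ -‿distribʳ-* x _ ⟨
    - (x * coeff p n)          ≈⟨ -‿distribˡ-* x _ ⟩
    - x * coeff p n            ≈⟨ coeff-scale (- x) p n ⟨
    coeff (scale (- x) p) n    ∎

  module _ (M : Poly) where

    mkCongMod : ∀ A B W → (∀ n → coeff A n - coeff B n ≈ conv (coeff W) (coeff M) n) → CongMod A B M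
    mkCongMod A B W e = W , λ n → begin
      coeff (A -ₚ B) n                ≈⟨ coeff--ₚ A B n ⟩
      coeff A n - coeff B n           ≈⟨ e n ⟩
      conv (coeff W) (coeff M) n      ≈⟨ coeff-*ₚ W M n ⟨
      coeff (W *ₚ M) n                ∎

    congMod-coeff : ∀ A B → ((W , _) : CongMod A B M) →
                    ∀ n → coeff A n - coeff B n ≈ conv (coeff W) (coeff M) n
    congMod-coeff A B (W , e) n = begin
      coeff A n - coeff B n           ≈⟨ coeff--ₚ A B n ⟨
      coeff (A -ₚ B) n                ≈⟨ e n ⟩
      coeff (W *ₚ M) n                ≈⟨ coeff-*ₚ W M n ⟩
      conv (coeff W) (coeff M) n      ∎

    ≈ₚ⇒congMod : ∀ A B → A ≈ₚ B → CongMod A B M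
    ≈ₚ⇒congMod A B A≈B = mkCongMod A B [] λ n →
      trans (+-congʳ (A≈B n)) (trans (-‿inverseʳ _) (sym (conv-zeroˡ (coeff M) n)))

    congMod-sym : ∀ {A B} → CongMod A B M → CongMod B A M
    congMod-sym {A} {B} A≡B@(W , _) = mkCongMod B A (-_ₚ W) λ n → begin
      coeff B n - coeff A n                ≈⟨ ⁻¹-anti-homo‿- (coeff A n) (coeff B n) ⟨
      - (coeff A n - coeff B n)            ≈⟨ -‿cong (congMod-coeff A B A≡B n) ⟩
      - conv (coeff W) (coeff M) n         ≈⟨ conv-negˡ (coeff W) (coeff M) n ⟨
      conv (λ k → - coeff W k) (coeff M) n ≈⟨ conv-cong (λ k → sym (coeff-negₚ W k)) (λ _ → refl) n ⟩
      conv (coeff (-_ₚ W)) (coeff M) n     ∎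

    congMod-trans : ∀ {A B D} → CongMod A B M → CongMod B D M → CongMod A D M
    congMod-trans {A} {B} {D} A≡B@(W₁ , _) B≡D@(W₂ , _) = mkCongMod A D (W₁ +ₚ W₂) λ n → begin
      coeff A n - coeff D n
        ≈⟨ telescope (coeff A n) (coeff B n) (coeff D n) ⟨
      (coeff A n - coeff B n) + (coeff B n - coeff D n)
        ≈⟨ +-cong (congMod-coeff A B A≡B n) (congMod-coeff B D B≡D n) ⟩
      conv (coeff W₁) (coeff M) n + conv (coeff W₂) (coeff M) n
        ≈⟨ conv-+ˡ (coeff W₁) (coeff W₂) (coeff M) n ⟨
      conv (λ k → coeff W₁ k + coeff W₂ k) (coeff M) n
        ≈⟨ conv-cong (λ k → sym (coeff-+ₚ W₁ W₂ k)) (λ _ → refl) n ⟩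
      conv (coeff (W₁ +ₚ W₂)) (coeff M) n
        ∎
      where
      telescope : ∀ a b c → (a - b) + (b - c) ≈ a - c
      telescope a b c = begin
        (a - b) + (b - c)   ≈⟨ +-assoc a (- b) (b - c) ⟩
        a + (- b + (b - c)) ≈⟨ +-congˡ (+-assoc (- b) b (- c)) ⟨
        a + ((- b + b) - c) ≈⟨ +-congˡ (+-congʳ (-‿inverseˡ b)) ⟩
        a + (0# - c)        ≈⟨ +-congˡ (+-identityˡ (- c)) ⟩
        a - c               ∎

    congMod-setoid : Setoid c (c ⊔ ℓ)
    congMod-setoid = record
      { Carrier       = Poly
      ; _≈_           = λ A B → CongMod A B M
      ; isEquivalence = record
        { refl  = λ {A} → ≈ₚ⇒congMod A A (λ _ → refl)
        ; sym   = λ {A B} → congMod-sym {A} {B}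
        ; trans = λ {A B D} → congMod-trans {A} {B} {D}
        }
      }

    congMod-scale : ∀ x A B → CongMod A B M → CongMod (scale x A) (scale x B) M
    congMod-scale x A B A≡B@(W , _) = mkCongMod (scale x A) (scale x B) (scale x W) λ n → begin
      coeff (scale x A) n - coeff (scale x B) n  ≈⟨ +-cong (coeff-scale x A n) (-‿cong (coeff-scale x B n)) ⟩
      x * coeff A n - x * coeff B n              ≈⟨ x[y-z]≈xy-xz x _ _ ⟨
      x * (coeff A n - coeff B n)                ≈⟨ *-congˡ (congMod-coeff A B A≡B n) ⟩
      x * conv (coeff W) (coeff M) n             ≈⟨ conv-*ˡ x (coeff W) (coeff M) n ⟨
      conv (λ k → x * coeff W k) (coeff M) n     ≈⟨ conv-cong (λ k → sym (coeff-scale x W k)) (λ _ → refl) n ⟩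
      conv (coeff (scale x W)) (coeff M) n       ∎

    *ₚ-congMod-[] : ∀ W → CongMod (W *ₚ M) [] M
    *ₚ-congMod-[] W = W , λ n → trans (coeff--ₚ (W *ₚ M) [] n) (trans (+-congˡ -0#≈0#) (+-identityʳ _))

module CongModReasoning {c ℓ} (R : CommutativeRing c ℓ) (M : FieldPoly.Poly R) where
  open FieldPoly R using (_≈ₚ_)
  open PolynomialCoefficients R using (congMod-setoid; ≈ₚ⇒congMod)
  open import Relation.Binary.Reasoning.Setoid (congMod-setoid M) public

  infixr 2 step-≈ₚ
  step-≈ₚ : ∀ A {B D} → B IsRelatedTo D → A ≈ₚ B → A IsRelatedTo D
  step-≈ₚ A {B} B∼D A≈B = ≈-go (≈ₚ⇒congMod M A B A≈B) B∼D
  syntax step-≈ₚ A B∼D A≈B = A ≈ₚ⟨ A≈B ⟩ B∼D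

module HasseDerivative {c ℓ} (R : CommutativeRing c ℓ) where
  open CommutativeRing R renaming (Carrier to F)
  open FieldPoly R
  open PolynomialCoefficients R
  open import Algebra.Properties.Semiring.Mult semiring using (_×_; ×-homo-1; ×-homo-+)
  open import Algebra.Properties.Ring ring using (x[y-z]≈xy-xz; -‿+-comm; -‿involutive)
  open Characteristic R using (InteriorBinomialsVanish)
  open import Relation.Binary.Reasoning.Setoid setoid

  hasseSeq : ℕ → Seq → Seq
  hasseSeq l a n = ((l ℕ.+ n) C l) × 1# * a (l ℕ.+ n)

  hasseSeq-cong : ∀ l {a b : Seq} → (∀ n → a n ≈ b n) → ∀ n → hasseSeq l a n ≈ hasseSeq l b n
  hasseSeq-cong l a≈b n = *-congˡ (a≈b (l ℕ.+ n))

  coeffᶻ-+ₚ : ∀ S T l n → coeff (PP.coeff (S PP.+ₚ T) l) n ≈ coeff (PP.coeff S l) n + coeff (PP.coeff T l) n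
  coeffᶻ-+ₚ []      T       l       n = sym (+-identityˡ _)
  coeffᶻ-+ₚ (s ∷ S) []      zero    n = sym (+-identityʳ _)
  coeffᶻ-+ₚ (s ∷ S) []      (suc l) n = sym (+-identityʳ _)
  coeffᶻ-+ₚ (s ∷ S) (t ∷ T) zero    n = coeff-+ₚ s t n
  coeffᶻ-+ₚ (s ∷ S) (t ∷ T) (suc l) n = coeffᶻ-+ₚ S T l n

  coeffᶻ-scale : ∀ p S l n → coeff (PP.coeff (PP.scale p S) l) n ≈ coeff (p *ₚ PP.coeff S l) n
  coeffᶻ-scale p []      l       n = sym (coeff-*ₚ[] p n)
  coeffᶻ-scale p (s ∷ S) zero    n = refl
  coeffᶻ-scale p (s ∷ S) (suc l) n = coeffᶻ-scale p S l n

  coeffᶻ-1*ₚ : ∀ S l n → coeff (PP.coeff (((1# ∷ []) ∷ []) PP.*ₚ S) l) n ≈ coeff (PP.coeff S l) n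
  coeffᶻ-1*ₚ S l n = begin
    coeff (PP.coeff (PP.scale (1# ∷ []) S PP.+ₚ ([] ∷ [])) l) n
      ≈⟨ coeffᶻ-+ₚ (PP.scale (1# ∷ []) S) ([] ∷ []) l n ⟩
    coeff (PP.coeff (PP.scale (1# ∷ []) S) l) n + coeff (PP.coeff ([] ∷ []) l) n
      ≈⟨ +-cong (coeffᶻ-scale (1# ∷ []) S l n) (zeroᶻ l) ⟩
    coeff ((1# ∷ []) *ₚ PP.coeff S l) n + 0#
      ≈⟨ +-identityʳ _ ⟩
    coeff ((1# ∷ []) *ₚ PP.coeff S l) n
      ≈⟨ coeff-1*ₚ (PP.coeff S l) n ⟩
    coeff (PP.coeff S l) n
      ∎
    where
    zeroᶻ : ∀ l → coeff (PP.coeff ([] ∷ []) l) n ≈ 0#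
    zeroᶻ zero    = refl
    zeroᶻ (suc l) = refl

  -- X ∷ (1# ∷ []) ∷ [] is X + Z in F[X][Z].
  coeffᶻ-[X+Z]*ₚ : ∀ S l n → coeff (PP.coeff ((X ∷ (1# ∷ []) ∷ []) PP.*ₚ S) l) n
                             ≈ shift 1 (coeff (PP.coeff S l)) n + coeff (PP.coeff ([] ∷ S) l) n
  coeffᶻ-[X+Z]*ₚ S l n = begin
    coeff (PP.coeff (PP.scale X S PP.+ₚ ([] ∷ (((1# ∷ []) ∷ []) PP.*ₚ S))) l) n
      ≈⟨ coeffᶻ-+ₚ (PP.scale X S) _ l n ⟩
    coeff (PP.coeff (PP.scale X S) l) n + coeff (PP.coeff ([] ∷ (((1# ∷ []) ∷ []) PP.*ₚ S)) l) n
      ≈⟨ +-cong (trans (coeffᶻ-scale X S l n) (coeff-X*ₚ (PP.coeff S l) n)) (Z*ₚ l) ⟩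
    shift 1 (coeff (PP.coeff S l)) n + coeff (PP.coeff ([] ∷ S) l) n
      ∎
    where
    Z*ₚ : ∀ l → coeff (PP.coeff ([] ∷ (((1# ∷ []) ∷ []) PP.*ₚ S)) l) n ≈ coeff (PP.coeff ([] ∷ S) l) n
    Z*ₚ zero    = refl
    Z*ₚ (suc l) = coeffᶻ-1*ₚ S l n

  coeff-hasse-∷ : ∀ x p l n →
                  coeff (hasse l (x ∷ p)) n
                  ≈ coeff (PP.coeff ((x ∷ []) ∷ []) l) n
                    + (shift 1 (coeff (hasse l p)) n + coeff (PP.coeff ([] ∷ shiftSubst p) l) n)
  coeff-hasse-∷ x p l n =
    trans (coeffᶻ-+ₚ ((x ∷ []) ∷ []) ((X ∷ (1# ∷ []) ∷ []) PP.*ₚ shiftSubst p) l n)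
          (+-congˡ (coeffᶻ-[X+Z]*ₚ (shiftSubst p) l n))

  private
    1×1*x≈x : ∀ x → 1 × 1# * x ≈ x
    1×1*x≈x x = trans (*-congʳ (×-homo-1 1#)) (*-identityˡ x)

  hasse-pascal : ∀ t l x → (t C l) × 1# * x + (t C suc l) × 1# * x ≈ (suc t C suc l) × 1# * x
  hasse-pascal t l x = begin
    (t C l) × 1# * x + (t C suc l) × 1# * x     ≈⟨ distribʳ x _ _ ⟨
    ((t C l) × 1# + (t C suc l) × 1#) * x       ≈⟨ *-congʳ (×-homo-+ 1# (t C l) (t C suc l)) ⟨
    (t C l ℕ.+ t C suc l) × 1# * x              ≡⟨ ≡.cong (λ k → k × 1# * x) (nCk+nC[k+1]≡[n+1]C[k+1] t l) ⟩
    (suc t C suc l) × 1# * x                    ∎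

  coeff-hasse : ∀ l p n → coeff (hasse l p) n ≈ hasseSeq l (coeff p) n
  coeff-hasse l       []      n       = sym (zeroʳ _)
  coeff-hasse zero    (x ∷ p) zero    = begin
    coeff (hasse 0 (x ∷ p)) 0                 ≈⟨ coeff-hasse-∷ x p 0 0 ⟩
    x + (0# + 0#)                             ≈⟨ trans (+-congˡ (+-identityˡ 0#)) (+-identityʳ x) ⟩
    x                                         ≈⟨ 1×1*x≈x x ⟨
    hasseSeq 0 (coeff (x ∷ p)) 0              ∎
  coeff-hasse zero    (x ∷ p) (suc n) = begin
    coeff (hasse 0 (x ∷ p)) (suc n)           ≈⟨ coeff-hasse-∷ x p 0 (suc n) ⟩
    0# + (coeff (hasse 0 p) n + 0#)           ≈⟨ trans (+-identityˡ _) (+-identityʳ _) ⟩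
    coeff (hasse 0 p) n                       ≈⟨ coeff-hasse 0 p n ⟩
    hasseSeq 0 (coeff (x ∷ p)) (suc n)        ∎
  coeff-hasse (suc l) (x ∷ p) zero    = begin
    coeff (hasse (suc l) (x ∷ p)) 0           ≈⟨ coeff-hasse-∷ x p (suc l) 0 ⟩
    0# + (0# + coeff (hasse l p) 0)           ≈⟨ trans (+-identityˡ _) (+-identityˡ _) ⟩
    coeff (hasse l p) 0                       ≈⟨ coeff-hasse l p 0 ⟩
    ((l ℕ.+ 0) C l) × 1# * coeff p (l ℕ.+ 0)  ≡⟨ ≡.cong (λ k → k × 1# * coeff p (l ℕ.+ 0)) diagonal ⟩
    hasseSeq (suc l) (coeff (x ∷ p)) 0        ∎
    where
    diagonal : (l ℕ.+ 0) C l ≡.≡ suc (l ℕ.+ 0) C suc l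
    diagonal rewrite ℕ.+-identityʳ l = ≡.trans (nCn≡1 l) (≡.sym (nCn≡1 (suc l)))
  coeff-hasse (suc l) (x ∷ p) (suc n) = begin
    coeff (hasse (suc l) (x ∷ p)) (suc n)
      ≈⟨ coeff-hasse-∷ x p (suc l) (suc n) ⟩
    0# + (coeff (hasse (suc l) p) n + coeff (hasse l p) (suc n))
      ≈⟨ +-identityˡ _ ⟩
    coeff (hasse (suc l) p) n + coeff (hasse l p) (suc n)
      ≈⟨ +-cong (coeff-hasse (suc l) p n) (coeff-hasse l p (suc n)) ⟩
    hasseSeq (suc l) (coeff p) n + hasseSeq l (coeff p) (suc n)
      ≈⟨ +-comm _ _ ⟩
    hasseSeq l (coeff p) (suc n) + hasseSeq (suc l) (coeff p) n
      ≡⟨ ≡.cong (λ t → hasseSeq l (coeff p) (suc n) + (t C suc l) × 1# * coeff p t) (ℕ.+-suc l n) ⟨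
    hasseSeq l (coeff p) (suc n) + ((l ℕ.+ suc n) C suc l) × 1# * coeff p (l ℕ.+ suc n)
      ≈⟨ hasse-pascal (l ℕ.+ suc n) l (coeff p (l ℕ.+ suc n)) ⟩
    hasseSeq (suc l) (coeff (x ∷ p)) (suc n)
      ∎

  hasse-cong : ∀ l A B → A ≈ₚ B → hasse l A ≈ₚ hasse l B
  hasse-cong l A B A≈B n =
    trans (coeff-hasse l A n) (trans (hasseSeq-cong l A≈B n) (sym (coeff-hasse l B n)))

  hasse-zero : ∀ A → hasse 0 A ≈ₚ A
  hasse-zero A n = trans (coeff-hasse 0 A n) (1×1*x≈x (coeff A n))

  hasseSeq-shift1 : ∀ m (a : Seq) n →
                    hasseSeq (suc m) (shift 1 a) n ≈ hasseSeq m a n + shift 1 (hasseSeq (suc m) a) n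
  hasseSeq-shift1 m a n = begin
    (suc (m ℕ.+ n) C suc m) × 1# * a (m ℕ.+ n)                       ≈⟨ hasse-pascal (m ℕ.+ n) m (a (m ℕ.+ n)) ⟨
    hasseSeq m a n + ((m ℕ.+ n) C suc m) × 1# * a (m ℕ.+ n)           ≈⟨ +-congˡ (lower n) ⟩
    hasseSeq m a n + shift 1 (hasseSeq (suc m) a) n                  ∎
    where
    lower : ∀ n → ((m ℕ.+ n) C suc m) × 1# * a (m ℕ.+ n) ≈ shift 1 (hasseSeq (suc m) a) n
    lower zero    = begin
      ((m ℕ.+ 0) C suc m) × 1# * a (m ℕ.+ 0)  ≡⟨ ≡.cong (λ k → k × 1# * a (m ℕ.+ 0)) (k>n⇒nCk≡0 m+0<1+m) ⟩
      0# * a (m ℕ.+ 0)                        ≈⟨ zeroˡ _ ⟩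
      0#                                      ∎
      where m+0<1+m = ℕ.s≤s (ℕ.≤-reflexive (ℕ.+-identityʳ m))
    lower (suc n) = reflexive (≡.cong (λ t → (t C suc m) × 1# * a t) (ℕ.+-suc m n))

  module _ {q} (q-binomials-vanish : InteriorBinomialsVanish q) where

    [q+s]Cj≈sCj : ∀ s j → j ℕ.< q → ((q ℕ.+ s) C j) × 1# ≈ (s C j) × 1#
    [q+s]Cj≈sCj s       zero    _   = refl
    [q+s]Cj≈sCj zero    (suc j) j<q rewrite ℕ.+-identityʳ q = q-binomials-vanish (suc j) (ℕ.s≤s ℕ.z≤n) j<q
    [q+s]Cj≈sCj (suc s) (suc j) j<q rewrite ℕ.+-suc q s = begin
      (suc (q ℕ.+ s) C suc j) × 1#
        ≈⟨ pascal (q ℕ.+ s) j ⟩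
      ((q ℕ.+ s) C j) × 1# + ((q ℕ.+ s) C suc j) × 1#
        ≈⟨ +-cong ([q+s]Cj≈sCj s j (ℕ.<-trans (ℕ.n<1+n j) j<q)) ([q+s]Cj≈sCj s (suc j) j<q) ⟩
      (s C j) × 1# + (s C suc j) × 1#
        ≈⟨ pascal s j ⟨
      (suc s C suc j) × 1#
        ∎
      where
      pascal : ∀ n k → (suc n C suc k) × 1# ≈ (n C k) × 1# + (n C suc k) × 1#
      pascal n k = trans (reflexive (≡.cong (_× 1#) (≡.sym (nCk+nC[k+1]≡[n+1]C[k+1] n k))))
                         (×-homo-+ 1# (n C k) (n C suc k))

    hasse-shiftq-at : ∀ j s (a : Seq) → j ℕ.< q →
                      ((q ℕ.+ s) C j) × 1# * shift q a (q ℕ.+ s) ≈ (s C j) × 1# * a s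
    hasse-shiftq-at j s a j<q = *-cong ([q+s]Cj≈sCj s j j<q) (reflexive (shift-+ q a s))

    hasseSeq-shiftq-below : ∀ j (a : Seq) n → j ℕ.< q → n ℕ.< q → hasseSeq j (shift q a) n ≈ 0#
    hasseSeq-shiftq-below j a n j<q n<q with q ℕ.≤? j ℕ.+ n
    ... | no  q≰j+n = trans (*-congˡ (reflexive (shift-< q a (ℕ.≰⇒> q≰j+n)))) (zeroʳ _)
    ... | yes q≤j+n with ℕ.m≤n⇒∃[o]m+o≡n q≤j+n
    ...   | r , q+r≡j+n = begin
      ((j ℕ.+ n) C j) × 1# * shift q a (j ℕ.+ n)   ≡⟨ ≡.cong (λ k → (k C j) × 1# * shift q a k) q+r≡j+n ⟨
      ((q ℕ.+ r) C j) × 1# * shift q a (q ℕ.+ r)   ≈⟨ hasse-shiftq-at j r a j<q ⟩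
      (r C j) × 1# * a r                           ≡⟨ ≡.cong (λ k → k × 1# * a r) (k>n⇒nCk≡0 r<j) ⟩
      0# * a r                                     ≈⟨ zeroˡ (a r) ⟩
      0#                                           ∎
      where
      r<j : r ℕ.< j
      r<j = ℕ.+-cancelˡ-< q r j (≡.subst (ℕ._< q ℕ.+ j) (≡.sym q+r≡j+n)
              (≡.subst (j ℕ.+ n ℕ.<_) (ℕ.+-comm j q) (ℕ.+-monoʳ-< j n<q)))

    hasseSeq-shiftq : ∀ j (a : Seq) n → j ℕ.< q → hasseSeq j (shift q a) n ≈ shift q (hasseSeq j a) n
    hasseSeq-shiftq j a n j<q with q ℕ.≤? n
    ... | no  q≰n = trans (hasseSeq-shiftq-below j a n j<q n<q) (reflexive (≡.sym (shift-< q _ n<q)))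
      where n<q = ℕ.≰⇒> q≰n
    ... | yes q≤n with ℕ.m≤n⇒∃[o]m+o≡n q≤n
    ...   | t , ≡.refl = begin
      ((j ℕ.+ (q ℕ.+ t)) C j) × 1# * shift q a (j ℕ.+ (q ℕ.+ t))
        ≡⟨ ≡.cong (λ k → (k C j) × 1# * shift q a k) (m+[n+o]≡n+[m+o] j q t) ⟩
      ((q ℕ.+ (j ℕ.+ t)) C j) × 1# * shift q a (q ℕ.+ (j ℕ.+ t))
        ≈⟨ hasse-shiftq-at j (j ℕ.+ t) a j<q ⟩
      hasseSeq j a t
        ≡⟨ shift-+ q (hasseSeq j a) t ⟨
      shift q (hasseSeq j a) (q ℕ.+ t)
        ∎

    hasseSeq-mulΛ : ∀ m (a : Seq) n → suc m ℕ.< q →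
                    hasseSeq (suc m) (mulΛ q a) n + hasseSeq m a n ≈ mulΛ q (hasseSeq (suc m) a) n
    hasseSeq-mulΛ m a n m<q = begin
      hasseSeq (suc m) (mulΛ q a) n + hasseSeq m a n
        ≈⟨ +-congʳ (x[y-z]≈xy-xz _ _ _) ⟩
      (hasseSeq (suc m) (shift q a) n - hasseSeq (suc m) (shift 1 a) n) + hasseSeq m a n
        ≈⟨ +-congʳ (+-cong (hasseSeq-shiftq (suc m) a n m<q) (-‿cong (hasseSeq-shift1 m a n))) ⟩
      (shift q H n - (hasseSeq m a n + shift 1 H n)) + hasseSeq m a n
        ≈⟨ cancel (shift q H n) (hasseSeq m a n) (shift 1 H n) ⟩
      mulΛ q H n
        ∎
      where
      H = hasseSeq (suc m) a
      cancel : ∀ x y z → (x - (y + z)) + y ≈ x - z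
      cancel x y z = begin
        (x - (y + z)) + y      ≈⟨ +-assoc x _ y ⟩
        x + (- (y + z) + y)    ≈⟨ +-congˡ (+-congʳ (-‿+-comm y z)) ⟨
        x + ((- y - z) + y)    ≈⟨ +-congˡ (+-congʳ (+-comm (- y) (- z))) ⟩
        x + ((- z - y) + y)    ≈⟨ +-congˡ (+-assoc (- z) (- y) y) ⟩
        x + (- z + (- y + y))  ≈⟨ +-congˡ (+-congˡ (-‿inverseˡ y)) ⟩
        x + (- z + 0#)         ≈⟨ +-congˡ (+-identityʳ (- z)) ⟩
        x - z                  ∎

    hasse-*ₚΛ : ∀ m A → suc m ℕ.< q → CongMod (hasse (suc m) (A *ₚ Λ q)) (-_ₚ (hasse m A)) (Λ q)
    hasse-*ₚΛ m A m<q = hasse (suc m) A , λ n → begin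
      coeff (hasse (suc m) (A *ₚ Λ q) -ₚ -_ₚ (hasse m A)) n
        ≈⟨ coeff--ₚ (hasse (suc m) (A *ₚ Λ q)) _ n ⟩
      coeff (hasse (suc m) (A *ₚ Λ q)) n - coeff (-_ₚ (hasse m A)) n
        ≈⟨ +-congˡ (trans (-‿cong (coeff-negₚ (hasse m A) n)) (-‿involutive _)) ⟩
      coeff (hasse (suc m) (A *ₚ Λ q)) n + coeff (hasse m A) n
        ≈⟨ +-cong (trans (coeff-hasse (suc m) (A *ₚ Λ q) n) (hasseSeq-cong (suc m) (coeff-*ₚΛ q A) n))
                  (coeff-hasse m A n) ⟩
      hasseSeq (suc m) (mulΛ q (coeff A)) n + hasseSeq m (coeff A) n
        ≈⟨ hasseSeq-mulΛ m (coeff A) n m<q ⟩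
      mulΛ q (hasseSeq (suc m) (coeff A)) n
        ≈⟨ mulΛ-cong q (coeff-hasse (suc m) A) n ⟨
      mulΛ q (coeff (hasse (suc m) A)) n
        ≈⟨ coeff-*ₚΛ q (hasse (suc m) A) n ⟨
      coeff (hasse (suc m) A *ₚ Λ q) n
        ∎

    hasseSub-*ₚΛ : ∀ l i A → l ℕ.< q →
                   CongMod (hasseSub l i (A *ₚ Λ q)) (-_ₚ (hasseSub l (suc i) A)) (Λ q)
    hasseSub-*ₚΛ zero    zero    A _   =
      congMod-trans (Λ q) {hasse 0 AΛ} {AΛ} {[]}
        (≈ₚ⇒congMod (Λ q) (hasse 0 AΛ) AΛ (hasse-zero AΛ)) (*ₚ-congMod-[] (Λ q) A)
      where AΛ = A *ₚ Λ q
    hasseSub-*ₚΛ (suc l) zero    A l<q = hasse-*ₚΛ l A l<q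
    hasseSub-*ₚΛ zero    (suc i) A _   = ≈ₚ⇒congMod (Λ q) [] [] (λ _ → refl)
    hasseSub-*ₚΛ (suc l) (suc i) A l<q = hasseSub-*ₚΛ l i A (ℕ.<-trans (ℕ.n<1+n l) l<q)

module HasseModΛ {c ℓ} (R : CommutativeRing c ℓ) where
  open CommutativeRing R renaming (Carrier to F)
  open FieldPoly R
  open PolynomialCoefficients R
  open HasseDerivative R
  open Characteristic R using (InteriorBinomialsVanish)

  module _ {q} (q-binomials-vanish : InteriorBinomialsVanish q) where
    open CongModReasoning R (Λ q)

    hasse-*ₚΛ^ : ∀ i A l → l < q →
                 CongMod (hasse l (A *ₚ (Λ q ^ₚ i))) (scale (signPow i) (hasseSub l i A)) (Λ q)
    hasse-*ₚΛ^ zero    A l _   = begin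
      hasse l (A *ₚ (1# ∷ []))  ≈ₚ⟨ hasse-cong l (A *ₚ (1# ∷ [])) A (coeff-*ₚ1 A) ⟩
      hasse l A                 ≈ₚ⟨ (λ n → sym (trans (coeff-scale 1# (hasse l A) n) (*-identityˡ _))) ⟩
      scale 1# (hasse l A)      ∎
    hasse-*ₚΛ^ (suc i) A l l<q = begin
      hasse l (A *ₚ (Λ q *ₚ Λ q ^ₚ i))
        ≈ₚ⟨ hasse-cong l (A *ₚ (Λ q *ₚ Λ q ^ₚ i)) ((A *ₚ Λ q) *ₚ Λ q ^ₚ i) (*ₚ-Λ-assoc q A (Λ q ^ₚ i)) ⟩
      hasse l ((A *ₚ Λ q) *ₚ Λ q ^ₚ i)
        ≈⟨ hasse-*ₚΛ^ i (A *ₚ Λ q) l l<q ⟩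
      scale (signPow i) (hasseSub l i (A *ₚ Λ q))
        ≈⟨ congMod-scale (Λ q) (signPow i) (hasseSub l i (A *ₚ Λ q)) (-_ₚ (hasseSub l (suc i) A))
                         (hasseSub-*ₚΛ q-binomials-vanish l i A l<q) ⟩
      scale (signPow i) (-_ₚ (hasseSub l (suc i) A))
        ≈ₚ⟨ scale-negₚ (signPow i) (hasseSub l (suc i) A) ⟩
      scale (signPow (suc i)) (hasseSub l (suc i) A)
        ∎

lemma2p4 : ∀ {c ℓ} (F : CommutativeRing c ℓ) → IsField F
    → (q : ℕ) → IsPrimePower q → HasCardinality F q
    → (U V : FieldPoly.Poly F) → FieldPoly.degLt F V q
    → (i : ℕ) → FieldPoly._≈ₚ_ F U (FieldPoly._*ₚ_ F V (FieldPoly._^ₚ_ F (FieldPoly.Λ F q) i))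
    → (l : ℕ) → l < q
    → FieldPoly.CongMod F (FieldPoly.hasse F l U)
        (FieldPoly.scale F (FieldPoly.signPow F i) (FieldPoly.hasseSub F l i V))
        (FieldPoly.Λ F q)
lemma2p4 F isField q q-prime-power card U V _ i U≈VΛ^i l l<q = begin
  hasse l U                                   ≈ₚ⟨ hasse-cong l U (V *ₚ Λ q ^ₚ i) U≈VΛ^i ⟩
  hasse l (V *ₚ Λ q ^ₚ i)                     ≈⟨ hasse-*ₚΛ^ vanish i V l l<q ⟩
  scale (signPow i) (hasseSub l i V)          ∎
  where
  open FieldPoly F
  open HasseDerivative F
  open HasseModΛ F
  open CongModReasoning F (Λ q)
  vanish = Characteristic.q-binomials-vanish F isField q q-prime-power card
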